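{- Let $\mathcal{A}$ be an OCAPT with parameter set $X$, initial state $q_0$ and target set $F$. If there is a valuation $V$ such that all infinite $V$-runs of $\mathcal{A}$ from $(q_0,0)$ reach $F$, then there is a valuation $V'$ such that $V'(x)=\exp(|\mathcal{A}|^{\mathcal{O}(1)})$ for all $x\in X$ (i.e. every $V'(x)$ is bounded by $2^{|\mathcal{A}|^{c}}$ for a constant $c$ independent of $\mathcal{A}$) and all infinite $V'$-runs of $\mathcal{A}$ from $(q_0,0)$ reach $F$.
   Context: An OCAPT is a tuple $\mathcal{A}=(Q,T,\delta,X)$ with $Q$ a finite set of states, $X$ a finite set of parameters, $T\subseteq Q\times Q$, and $\delta:T\to\mathit{Op}$, $\mathit{Op}$ consisting of updates $+a$ with $a\in\{ -1,0,1\}$, the zero test $=0$, and parametric tests $=x$, $\ge x$ ($x\in X$). A valuation is $V:X\to\mathbb{N}$. A $V$-run from $(q_0,c_0)$ is a sequence of configurations $(q_i,c_i)\in Q\times\mathbb{N}$ with $(q_i,q_{i+1})\in T$, where tests $=0,=x,\ge x$ require $c_i=0$, $c_i=V(x)$, $c_i\ge V(x)$ and keep the counter, and $+a$ gives $c_{i+1}=c_i+a$. A run reaches $F$ if some $q_i\in F$. $|\mathcal{A}|$ denotes the size of the description of $\mathcal{A}$. -}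

module Defs where

open import Data.Nat using (ℕ; zero; suc; _+_; _≤_)
open import Data.Fin using (Fin)
open import Data.Fin.Subset using (Subset; _∈_)
open import Data.Maybe using (Maybe; just; nothing)
open import Data.Product using (Σ; ∃; _×_; _,_; proj₁)
open import Data.List using (List; length; allFin; concatMap; mapMaybe)
open import Relation.Binary.PropositionalEquality using (_≡_)

data Op (nX : ℕ) : Set where
  add+1 : Op nX
  add-1 : Op nX
  add0  : Op nX
  zero? : Op nX
  eq?   : Fin nX → Op nX
  ge?   : Fin nX → Op nX

-- An OCAPT (Q, T, δ, X) with Q = Fin nQ and X = Fin nX.
-- T ⊆ Q × Q together with δ : T → Op is encoded as a partial function:
-- (q , q') ∈ T  iff  δ q q' ≡ just op, and then δ(q,q') = op.
record OCAPT : Set where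
  field
    nQ : ℕ
    nX : ℕ
    δ  : Fin nQ → Fin nQ → Maybe (Op nX)
open OCAPT public

Valuation : OCAPT → Set
Valuation A = Fin (nX A) → ℕ

data OpStep {nX : ℕ} (V : Fin nX → ℕ) : Op nX → ℕ → ℕ → Set where
  s+1  : ∀ {c} → OpStep V add+1 c (suc c)
  s-1  : ∀ {c} → OpStep V add-1 (suc c) c
  s0   : ∀ {c} → OpStep V add0 c c
  sz   : OpStep V zero? 0 0
  seq  : ∀ {x c} → c ≡ V x → OpStep V (eq? x) c c
  sge  : ∀ {x c} → V x ≤ c → OpStep V (ge? x) c c

Config : OCAPT → Set
Config A = Fin (nQ A) × ℕ

data Step (A : OCAPT) (V : Valuation A) : Config A → Config A → Set where
  step : ∀ {q q' c c'} (op : Op (nX A)) → δ A q q' ≡ just op →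
         OpStep V op c c' → Step A V (q , c) (q' , c')

IsInfRun : (A : OCAPT) → Valuation A → Config A → (ℕ → Config A) → Set
IsInfRun A V s ρ = (ρ 0 ≡ s) × (∀ i → Step A V (ρ i) (ρ (suc i)))

Reaches : (A : OCAPT) → Subset (nQ A) → (ℕ → Config A) → Set
Reaches A F ρ = ∃ λ i → proj₁ (ρ i) ∈ F

AllInfRunsReach : (A : OCAPT) → Valuation A → Fin (nQ A) → Subset (nQ A) → Set
AllInfRunsReach A V q0 F =
  ∀ (ρ : ℕ → Config A) → IsInfRun A V (q0 , 0) ρ → Reaches A F ρ

nTrans : OCAPT → ℕ
nTrans A = length (concatMap (λ q → mapMaybe (λ q' → δ A q q') (allFin (nQ A))) (allFin (nQ A)))

-- size |A| = |Q| + |T| + |X|  (polynomially equivalent to any standard encoding size)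
size : OCAPT → ℕ
size A = nQ A + nTrans A + nX A

module Submission where

-- Let n be the number of states and L = n!. Suppose no parameter value lies strictly between a
-- and b = a + n + 2 + L, and lower every value ≥ b by L. Then all infinite runs still reach F: an
-- infinite run avoiding F under the lowered valuation V₁ gives one under V. Heights up to a are
-- kept and heights from b − L on are raised by L. Inside the band between them only +1, −1, +0 and
-- ≥-tests passed by the low parameters can fire; when the run crosses the band, the first visits
-- of n + 1 consecutive heights repeat a state, giving a cycle of some height d ≤ n, and repeating
-- it L/d more times stretches the crossing by L. Only a bounded prefix of the V₁-run is needed:
-- either it climbs more than n levels above all parameters, and a rising cycle can be repeated
-- forever, or it repeats a configuration and the loop is simulated. Each lowering decreases the
-- sum of the values; once no such gap is left, every value is at most
-- (number of parameters) · (n + 2 + n!) ≤ 2^(|A|³).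

open import Defs
open import Data.Bool using (Bool; true; false; T)
open import Data.Empty using (⊥-elim)
open import Data.Fin using (Fin; zero; suc; toℕ; fromℕ<; combine; remQuot) renaming (_<_ to _<ᶠ_)
import Data.Fin.Properties as Fin
open import Data.Fin.Subset using (Subset; _∈_; _∉_; ∣_∣)
open import Data.Fin.Subset.Properties using (_∈?_; ∣p∣≤n; p⊂q⇒∣p∣<∣q∣; x∈p⇒∣p-x∣<∣p∣)
open import Data.Maybe using (Maybe; just; nothing)
open import Data.Nat
open import Data.Nat.Divisibility using (_∣_; divides; ∣-trans; m∣m*n; m≤n⇒m!∣n!)
open import Data.Nat.Induction using (<-rec)
open import Data.Nat.Properties
open import Algebra.Properties.CommutativeSemigroup +-commutativeSemigroup using (xy∙z≈xz∙y; xy∙z≈y∙xz)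
open import Algebra.Properties.Monoid.Sum +-0-monoid using (sum)
open import Data.Product using (Σ; ∃; ∃₂; _×_; _,_; proj₁; proj₂; map₁; map₂)
open import Data.Sum using (_⊎_; inj₁; inj₂)
open import Data.Vec using (tabulate)
open import Data.Vec.Properties using (lookup∘tabulate; []=⇒lookup; lookup⇒[]=)
open import Function using (flip; _∘_)
open import Level using (0ℓ)
open import Relation.Binary.Core using (Rel)
open import Relation.Binary.PropositionalEquality
open import Relation.Binary.Construct.Closure.ReflexiveTransitive as Star using (Star; ε; _◅_; _◅◅_; gmap)
open import Relation.Nullary using (yes; no; contradiction; ¬_; Dec; does)
open import Relation.Nullary.Decidable using (_⊎-dec_; _×-dec_; dec-true)
open import Relation.Unary using (Pred; _⊆_)

-- Chains and first visits

Star⁺ : {I : Set} → Rel I 0ℓ → Rel I 0ℓ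
Star⁺ R x z = ∃ λ y → R x y × Star R y z

module _ {I : Set} {R : Rel I 0ℓ} where

  forget⁺ : ∀ {x y} → Star⁺ R x y → Star R x y
  forget⁺ (_ , r , rs) = r ◅ rs

  infixr 5 _◅◅⁺_ _⁺◅◅_
  infixl 5 _▷_

  _◅◅⁺_ : ∀ {x y z} → Star R x y → Star⁺ R y z → Star⁺ R x z
  ε        ◅◅⁺ ys = ys
  (r ◅ rs) ◅◅⁺ ys = _ , r , rs ◅◅ forget⁺ ys

  _⁺◅◅_ : ∀ {x y z} → Star⁺ R x y → Star R y z → Star⁺ R x z
  (u , r , rs) ⁺◅◅ ys = u , r , rs ◅◅ ys

  _▷_ : ∀ {x y z} → Star R x y → R y z → Star⁺ R x z
  rs ▷ r = rs ◅◅⁺ (_ , r , ε)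

  nonempty : ∀ {x y} → Star R x y → x ≢ y → Star⁺ R x y
  nonempty ε       x≢x = contradiction refl x≢x
  nonempty (r ◅ rs) _  = _ , r , rs

  chain : (f : ℕ → I) → ∀ {i j} → i ≤ j → (∀ t → i ≤ t → t < j → R (f t) (f (suc t))) → Star R (f i) (f j)
  chain f i≤j next = go (≤⇒≤′ i≤j) next
    where
    go : ∀ {i j} → i ≤′ j → (∀ t → i ≤ t → t < j → R (f t) (f (suc t))) → Star R (f i) (f j)
    go ≤′-refl           _    = ε
    go (≤′-step i≤′j) next =
      go i≤′j (λ t i≤t t<j → next t i≤t (m≤n⇒m≤1+n t<j)) ◅◅ next _ (≤′⇒≤ i≤′j) ≤-refl ◅ ε

  chain⁺ : (f : ℕ → I) → ∀ {i j} → i < j → (∀ t → i ≤ t → t < j → R (f t) (f (suc t))) → Star⁺ R (f i) (f j)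
  chain⁺ f i<j next = _ , next _ ≤-refl i<j , chain f i<j (λ t i<t → next t (<⇒≤ i<t))

gmap⁺ : ∀ {I J : Set} {R : Rel I 0ℓ} {S : Rel J 0ℓ} (f : I → J) →
        (∀ {x y} → R x y → S (f x) (f y)) → ∀ {x y} → Star⁺ R x y → Star⁺ S (f x) (f y)
gmap⁺ f g (_ , r , rs) = _ , g r , gmap f g rs

last-at-most : (f : ℕ → ℕ) (M : ℕ) → f 0 ≤ M → ∀ t →
               ∃ λ s → s ≤ t × f s ≤ M × (∀ j → s < j → j ≤ t → M < f j)
last-at-most f M f₀≤M zero = 0 , z≤n , f₀≤M , λ { _ () z≤n }
last-at-most f M f₀≤M (suc t) with f (suc t) ≤? M
... | yes fₜ≤M = suc t , ≤-refl , fₜ≤M , λ j t<j j≤t → contradiction j≤t (<⇒≱ t<j)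
... | no fₜ≰M  with last-at-most f M f₀≤M t
...   | s , s≤t , fₛ≤M , above = s , m≤n⇒m≤1+n s≤t , fₛ≤M , above′
  where
  above′ : ∀ j → s < j → j ≤ suc t → M < f j
  above′ j s<j j≤1+t with m≤n⇒m<n∨m≡n j≤1+t
  ... | inj₁ j≤t = above j s<j (s≤s⁻¹ j≤t)
  ... | inj₂ refl = ≰⇒> fₜ≰M

module FirstVisit {I : Set} {R : Rel I 0ℓ} (level : I → ℕ)
                  (rise-≤1 : ∀ {x y} → R x y → level y ≤ suc (level x)) where

  -- a chain split at its first node of level l (at its end if it never reaches l)
  split : ℕ → ∀ {x y} → Star R x y → ∃ λ u → Star R x u × Star R u y
  split l {x} ε = x , ε , ε
  split l {x} (r ◅ xs) with level x ≟ l
  ... | yes _ = x , ε , r ◅ xs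
  ... | no _  = map₂ (map₁ (r ◅_)) (split l xs)

  visit : ℕ → ∀ {x y} → Star R x y → I
  visit l xs = proj₁ (split l xs)

  suffix : ∀ l {x y} (xs : Star R x y) → Star R (visit l xs) y
  suffix l xs = proj₂ (proj₂ (split l xs))

  visit-level : ∀ l {x y} (xs : Star R x y) → level x ≤ l → l ≤ level y → level (visit l xs) ≡ l
  visit-level l ε x≤l l≤y = ≤-antisym x≤l l≤y
  visit-level l {x} (r ◅ xs) x≤l l≤y with level x ≟ l
  ... | yes x≡l = x≡l
  ... | no x≢l  = visit-level l xs (≤-trans (rise-≤1 r) (≤∧≢⇒< x≤l x≢l)) l≤y

  visit-suffix : ∀ {l₀ l x y} (xs : Star R x y) → level x ≤ l₀ → l₀ ≤ l →
                 visit l (suffix l₀ xs) ≡ visit l xs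
  visit-suffix ε x≤l₀ l₀≤l = refl
  visit-suffix {l₀} {l} {x} (r ◅ xs) x≤l₀ l₀≤l with level x ≟ l₀
  ... | yes _ = refl
  ... | no x≢l₀ with level x ≟ l
  ...   | yes x≡l = contradiction (≤-antisym x≤l₀ (≤-trans l₀≤l (≤-reflexive (sym x≡l)))) x≢l₀
  ...   | no _    = visit-suffix xs (≤-trans (rise-≤1 r) (≤∧≢⇒< x≤l₀ x≢l₀)) l₀≤l

  record Repeat {k} (key : I → Fin k) (x y : I) : Set where
    field
      {u v}    : I
      before   : Star R x u
      loop     : Star R u v
      after    : Star R v y
      same-key : key u ≡ key v
      rises    : level u < level v
      short    : level v ≤ level u + k

  -- pigeonhole on the first visits of the levels level x, …, level x + k
  repeat : ∀ {k} (key : I → Fin k) {x y} (xs : Star R x y) → level x + k ≤ level y → Repeat key x y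
  repeat {k} key {x} {y} xs x+k≤y = from-pigeonhole (Fin.pigeonhole (n<1+n k) (λ i → key (visit (lvl i) xs)))
    where
    lvl : Fin (suc k) → ℕ
    lvl i = level x + toℕ i
    lvl≤y : ∀ i → lvl i ≤ level y
    lvl≤y i = ≤-trans (+-monoʳ-≤ (level x) (Fin.toℕ≤pred[n] i)) x+k≤y
    from-pigeonhole : (∃₂ λ i j → i <ᶠ j × key (visit (lvl i) xs) ≡ key (visit (lvl j) xs)) → Repeat key x y
    from-pigeonhole (i , j , i<j , same) = record
      { before   = proj₁ (proj₂ (split (lvl i) xs))
      ; loop     = proj₁ (proj₂ (split (lvl j) rest))
      ; after    = proj₂ (proj₂ (split (lvl j) rest))
      ; same-key = trans same (cong key (sym (visit-suffix xs (m≤m+n _ _) lvlᵢ≤lvlⱼ)))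
      ; rises    = subst₂ _<_ (sym lvl-u) (sym lvl-v) (+-monoʳ-< (level x) i<j)
      ; short    = subst₂ _≤_ (sym lvl-v) (cong (_+ k) (sym lvl-u))
                     (≤-trans (+-monoʳ-≤ (level x) (Fin.toℕ≤pred[n] j)) (+-monoˡ-≤ k (m≤m+n _ _)))
      }
      where
      rest = suffix (lvl i) xs
      lvlᵢ≤lvlⱼ = +-monoʳ-≤ (level x) (<⇒≤ i<j)
      lvl-u : level (visit (lvl i) xs) ≡ lvl i
      lvl-u = visit-level (lvl i) xs (m≤m+n _ _) (lvl≤y i)
      lvl-v : level (visit (lvl j) rest) ≡ lvl j
      lvl-v = visit-level (lvl j) rest (≤-trans (≤-reflexive lvl-u) lvlᵢ≤lvlⱼ) (lvl≤y j)

InfRun : (A : OCAPT) → Valuation A → Config A → Set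
InfRun A V s = ∃ (IsInfRun A V s)

IsRunPrefix : (A : OCAPT) → Valuation A → Config A → ℕ → (ℕ → Config A) → Set
IsRunPrefix A V s K ρ = (ρ 0 ≡ s) × (∀ t → t < K → Step A V (ρ t) (ρ (suc t)))

module Runs (A : OCAPT) (V : Valuation A) where

  Path : Rel (Config A) 0ℓ
  Path = Star (Step A V)

  Path⁺ : Rel (Config A) 0ℓ
  Path⁺ = Star⁺ (Step A V)

  Path⟨_⟩ : Bool → Rel (Config A) 0ℓ
  Path⟨ false ⟩ = Path
  Path⟨ true ⟩  = Path⁺

  forget : ∀ b {x y} → Path⟨ b ⟩ x y → Path x y
  forget false P = P
  forget true  P = forget⁺ P

  weaken : ∀ b {x y} → Path⁺ x y → Path⟨ b ⟩ x y
  weaken false P = forget⁺ P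
  weaken true  P = P

  infRun-cycling : (y : ℕ → Config A) → (∀ k → Path⁺ (y k) (y (suc k))) →
                   ∀ {s} → Path s (y 0) → InfRun A V s
  infRun-cycling y cycle {s} P = (λ t → here (pending t)) , refl , λ t → proj₂ (advance (pending t))
    where
    Pending : Set
    Pending = ∃₂ λ k x → Path x (y k)
    here : Pending → Config A
    here (_ , x , _) = x
    advance : (p : Pending) → Σ Pending λ p′ → Step A V (here p) (here p′)
    advance (k , x , s ◅ P) = (k , _ , P) , s
    advance (k , _ , ε) with cycle k
    ... | u , s , P = (suc k , u , P) , s
    pending : ℕ → Pending
    pending zero    = 0 , s , P
    pending (suc t) = proj₁ (advance (pending t))

avoiding : (A : OCAPT) → Subset (nQ A) → Fin (nQ A) → Fin (nQ A) → Maybe (Op (nX A))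
avoiding A F q q′ with q ∈? F | q′ ∈? F
... | no _ | no _ = δ A q q′
... | _    | _    = nothing

infixl 5 _∖_

_∖_ : (A : OCAPT) → Subset (nQ A) → OCAPT
A ∖ F = record { nQ = nQ A ; nX = nX A ; δ = avoiding A F }

module _ {A : OCAPT} {F : Subset (nQ A)} where

  avoiding-kept : ∀ {q q′} → q ∉ F → q′ ∉ F → avoiding A F q q′ ≡ δ A q q′
  avoiding-kept {q} {q′} q∉F q′∉F with q ∈? F | q′ ∈? F
  ... | no _     | no _      = refl
  ... | yes q∈F  | _         = ⊥-elim (q∉F q∈F)
  ... | no _     | yes q′∈F  = ⊥-elim (q′∉F q′∈F)

  avoiding-kept⁻ : ∀ {q q′ op} → avoiding A F q q′ ≡ just op → q ∉ F × δ A q q′ ≡ just op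
  avoiding-kept⁻ {q} {q′} eq with q ∈? F | q′ ∈? F
  ... | no q∉F | no _  = q∉F , eq
  ... | yes _  | _     with () ← eq
  ... | no _   | yes _ with () ← eq

  step-∖ : ∀ {V q c q′ c′} → Step A V (q , c) (q′ , c′) → q ∉ F → q′ ∉ F → Step (A ∖ F) V (q , c) (q′ , c′)
  step-∖ (step op eq s) q∉F q′∉F = step op (trans (avoiding-kept q∉F q′∉F) eq) s

  step-∖⁻ : ∀ {V q c y} → Step (A ∖ F) V (q , c) y → Step A V (q , c) y × q ∉ F
  step-∖⁻ (step op eq s) = step op (proj₂ (avoiding-kept⁻ eq)) s , proj₁ (avoiding-kept⁻ eq)

  -- F is either reached within the first K steps, or these steps form a run of A ∖ F
  reach-transfer : ∀ {V V₁ : Valuation A} {q₀} K →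
    (∀ ρ → IsRunPrefix (A ∖ F) V₁ (q₀ , 0) K ρ → InfRun (A ∖ F) V (q₀ , 0)) →
    AllInfRunsReach A V q₀ F → AllInfRunsReach A V₁ q₀ F
  reach-transfer K lift reach ρ (ρ₀ , steps) with anyUpTo? (λ t → proj₁ (ρ t) ∈? F) (suc K)
  ... | yes (t , _ , ρₜ∈F) = t , ρₜ∈F
  ... | no avoids with lift ρ (ρ₀ , λ t t<K → step-∖ (steps t) (λ ρₜ∈F → avoids (t , m≤n⇒m≤1+n t<K , ρₜ∈F))
                                                               (λ ρₜ₊₁∈F → avoids (suc t , s≤s t<K , ρₜ₊₁∈F)))
  ...   | ρ′ , ρ′₀ , steps′ with reach ρ′ (ρ′₀ , proj₁ ∘ step-∖⁻ ∘ steps′)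
  ...     | i , ρ′ᵢ∈F = contradiction ρ′ᵢ∈F (proj₂ (step-∖⁻ (steps′ i)))

step-unit : ∀ {A W q h q′ h′} → Step A W (q , h) (q′ , h′) → h′ ≤ suc h × h ≤ suc h′
step-unit (step _ _ s+1)     = ≤-refl , m≤n⇒m≤1+n (n≤1+n _)
step-unit (step _ _ s-1)     = m≤n⇒m≤1+n (n≤1+n _) , ≤-refl
step-unit (step _ _ s0)      = n≤1+n _ , n≤1+n _
step-unit (step _ _ sz)      = z≤n , z≤n
step-unit (step _ _ (seq _)) = n≤1+n _ , n≤1+n _
step-unit (step _ _ (sge _)) = n≤1+n _ , n≤1+n _

-- Walks above the parameters

module Walks (A : OCAPT) where

  open Runs A using (Path; Path⁺)

  -- Heights are relative to a base above every parameter satisfying Pass, so an edge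
  -- carries no zero or equality test.
  data Move (Pass : Pred (Fin (nX A)) 0ℓ) : Op (nX A) → ℕ → ℕ → Set where
    inc  : ∀ {r} → Move Pass add+1 r (suc r)
    dec  : ∀ {r} → Move Pass add-1 (suc r) r
    stay : ∀ {r} → Move Pass add0 r r
    pass : ∀ {x r} → Pass x → Move Pass (ge? x) r r

  data Edge (Pass : Pred (Fin (nX A)) 0ℓ) : Rel (Config A) 0ℓ where
    edge : ∀ {q q′ op r r′} → δ A q q′ ≡ just op → Move Pass op r r′ → Edge Pass (q , r) (q′ , r′)

  Walk : Pred (Fin (nX A)) 0ℓ → Rel (Config A) 0ℓ
  Walk Pass = Star (Edge Pass)

  infixl 6 _↑_

  _↑_ : Config A → ℕ → Config A
  (q , r) ↑ k = q , r + k

  module _ {Pass : Pred (Fin (nX A)) 0ℓ} where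

    edge-unit : ∀ {x y} → Edge Pass x y → proj₂ y ≤ suc (proj₂ x) × proj₂ x ≤ suc (proj₂ y)
    edge-unit (edge _ inc)      = ≤-refl , m≤n⇒m≤1+n (n≤1+n _)
    edge-unit (edge _ dec)      = m≤n⇒m≤1+n (n≤1+n _) , ≤-refl
    edge-unit (edge _ stay)     = n≤1+n _ , n≤1+n _
    edge-unit (edge _ (pass _)) = n≤1+n _ , n≤1+n _

    shift : ∀ k {x y} → Walk Pass x y → Walk Pass (x ↑ k) (y ↑ k)
    shift k = gmap (_↑ k) shift-edge
      where
      shift-edge : ∀ {x y} → Edge Pass x y → Edge Pass (x ↑ k) (y ↑ k)
      shift-edge (edge eq inc)      = edge eq inc
      shift-edge (edge eq dec)      = edge eq dec
      shift-edge (edge eq stay)     = edge eq stay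
      shift-edge (edge eq (pass p)) = edge eq (pass p)

    module _ {V : Valuation A} {c : ℕ} (passes : Pass ⊆ λ x → V x ≤ c) where

      edge-step : ∀ {x y} → Edge Pass x y → Step A V (x ↑ c) (y ↑ c)
      edge-step (edge eq inc)               = step add+1 eq s+1
      edge-step (edge eq dec)               = step add-1 eq s-1
      edge-step (edge eq stay)              = step add0 eq s0
      edge-step {_ , r} (edge eq (pass p))  = step (ge? _) eq (sge (≤-trans (passes p) (m≤n+m c r)))

      toPath : ∀ {x y} → Walk Pass x y → Path V (x ↑ c) (y ↑ c)
      toPath = gmap (_↑ c) edge-step

      toPath⁺ : ∀ {x y} → Walk Pass x y → proj₂ x ≢ proj₂ y → Path⁺ V (x ↑ c) (y ↑ c)
      toPath⁺ w x≢y = gmap⁺ (_↑ c) edge-step (nonempty w (x≢y ∘ cong proj₂))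

    up-edge : ∀ {W q h q′ r} → Step A W (q , h) (q′ , suc h) → Edge Pass (q , r) (q′ , suc r)
    up-edge (step add+1 eq s+1) = edge eq inc

    down-edge : ∀ {W q h q′ r} → Step A W (q , suc h) (q′ , h) → Edge Pass (q , suc r) (q′ , r)
    down-edge (step add-1 eq s-1) = edge eq dec

    module _ {s : Fin (nQ A)} {u d : ℕ} where

      shifted-cycle : Walk Pass (s , u) (s , u + d) → ∀ k → Walk Pass (s , u + k * d) (s , u + suc k * d)
      shifted-cycle C k = subst (λ h → Walk Pass (s , u + k * d) (s , h)) (+-assoc u d (k * d)) (shift (k * d) C)

      cycle-up : Walk Pass (s , u) (s , u + d) → ∀ k → Walk Pass (s , u) (s , u + k * d)
      cycle-up C zero    = subst (λ h → Walk Pass (s , u) (s , h)) (sym (+-identityʳ u)) ε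
      cycle-up C (suc k) = cycle-up C k ◅◅ shifted-cycle C k

      cycle-down : Walk Pass (s , u + d) (s , u) → ∀ k → Walk Pass (s , u + k * d) (s , u)
      cycle-down C zero    = subst (λ h → Walk Pass (s , h) (s , u)) (sym (+-identityʳ u)) ε
      cycle-down C (suc k) =
        subst (λ h → Walk Pass (s , h) (s , u + k * d)) (+-assoc u d (k * d)) (shift (k * d) C) ◅◅ cycle-down C k

    record Ascent (x y : Config A) : Set where
      field
        {s}     : Fin (nQ A)
        {u d}   : ℕ
        d>0     : 0 < d
        d≤n     : d ≤ nQ A
        before  : Walk Pass x (s , u)
        cycle   : Walk Pass (s , u) (s , u + d)
        after   : Walk Pass (s , u + d) y

    record Descent (x y : Config A) : Set where
      field
        {s}     : Fin (nQ A)
        {u d}   : ℕ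
        d>0     : 0 < d
        d≤n     : d ≤ nQ A
        before  : Walk Pass x (s , u + d)
        cycle   : Walk Pass (s , u + d) (s , u)
        after   : Walk Pass (s , u) y

    private
      same-state-higher : ∀ {u v : Config A} → proj₁ u ≡ proj₁ v → proj₂ u < proj₂ v →
                          v ≡ (proj₁ u , proj₂ u + (proj₂ v ∸ proj₂ u))
      same-state-higher refl u<v = cong (_ ,_) (sym (m+[n∸m]≡n (<⇒≤ u<v)))

      module Up   = FirstVisit {R = Edge Pass} proj₂ (λ e → proj₁ (edge-unit e))
      module Down = FirstVisit {R = flip (Edge Pass)} proj₂ (λ e → proj₂ (edge-unit e))

    ascent : ∀ {x y} → Walk Pass x y → proj₂ x + nQ A ≤ proj₂ y → Ascent x y
    ascent {y = y} w x+n≤y = record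
      { d>0    = m<n⇒0<n∸m rises
      ; d≤n    = m≤n+o⇒m∸n≤o _ _ short
      ; before = before
      ; cycle  = subst (Walk Pass _) v≡ loop
      ; after  = subst (λ v → Walk Pass v y) v≡ after
      }
      where
      open Up.Repeat (Up.repeat proj₁ w x+n≤y)
      v≡ = same-state-higher same-key rises

    descent : ∀ {x y} → Walk Pass x y → proj₂ y + nQ A ≤ proj₂ x → Descent x y
    descent {x} w y+n≤x = record
      { d>0    = m<n⇒0<n∸m rises
      ; d≤n    = m≤n+o⇒m∸n≤o _ _ short
      ; before = subst (Walk Pass x) v≡ (Star.reverse (λ e → e) after)
      ; cycle  = subst (λ z → Walk Pass z u) v≡ (Star.reverse (λ e → e) loop)
      ; after  = Star.reverse (λ e → e) before
      }
      where
      open Down.Repeat (Down.repeat proj₁ (Star.reverse (λ e → e) w) y+n≤x)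
      v≡ = same-state-higher same-key rises

    module _ {L} (L-divisible : ∀ d → 0 < d → d ≤ nQ A → d ∣ L) where

      pump-up : ∀ {q r q′ r′} → Walk Pass (q , r) (q′ , r′) → r + nQ A ≤ r′ → Walk Pass (q , r) (q′ , r′ + L)
      pump-up w r+n≤r′ with ascent w r+n≤r′
      ... | record { d>0 = d>0 ; d≤n = d≤n ; before = P ; cycle = C ; after = R }
          with L-divisible _ d>0 d≤n
      ...   | divides m refl = P ◅◅ cycle-up C m ◅◅ shift _ (C ◅◅ R)

      pump-down : ∀ {q r q′ r′} → Walk Pass (q , r) (q′ , r′) → r′ + nQ A ≤ r → Walk Pass (q , r + L) (q′ , r′)
      pump-down w r′+n≤r with descent w r′+n≤r
      ... | record { d>0 = d>0 ; d≤n = d≤n ; before = P ; cycle = C ; after = R }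
          with L-divisible _ d>0 d≤n
      ...   | divides m refl = shift _ (P ◅◅ C) ◅◅ cycle-down C m ◅◅ R

  module _ {W : Valuation A} {c e : ℕ} (separated : ∀ x → W x ≤ c ⊎ e ≤ W x) where

    -- strictly between c and e no zero or equality test can fire, and a ≥-test passes iff its parameter is ≤ c
    band-edge : ∀ {q r q′ h′} → 0 < r → r + c < e → Step A W (q , r + c) (q′ , h′) →
                ∃ λ r′ → h′ ≡ r′ + c × Edge (λ x → W x ≤ c) (q , r) (q′ , r′)
    band-edge {r = suc r} _ _ (step add+1 eq s+1) = suc (suc r) , refl , edge eq inc
    band-edge {r = suc r} _ _ (step add-1 eq s-1) = r , refl , edge eq dec
    band-edge {r = suc r} _ _ (step add0 eq s0)  = suc r , refl , edge eq stay
    band-edge {r = suc r} _ r+c<e (step (eq? x) eq (seq h≡x)) with separated x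
    ... | inj₁ Wx≤c = contradiction (≤-trans (≤-reflexive h≡x) Wx≤c) (<⇒≱ (m<n+m c (s≤s z≤n)))
    ... | inj₂ e≤Wx = contradiction (≤-trans e≤Wx (≤-reflexive (sym h≡x))) (<⇒≱ r+c<e)
    band-edge {r = suc r} _ r+c<e (step (ge? x) eq (sge Wx≤h)) with separated x
    ... | inj₁ Wx≤c = suc r , refl , edge eq (pass Wx≤c)
    ... | inj₂ e≤Wx = contradiction (≤-trans e≤Wx Wx≤h) (<⇒≱ r+c<e)

    band-edge↓ : ∀ {q h q′ h′} → c < h → h < e → Step A W (q , h) (q′ , h′) →
                 Edge (λ x → W x ≤ c) (q , h ∸ c) (q′ , h′ ∸ c)
    band-edge↓ {q} {h} {q′} c<h h<e s =
      relative (band-edge (m<n⇒0<n∸m c<h) (subst (_< e) (sym h≡) h<e) (subst (λ k → Step A W (q , k) _) (sym h≡) s))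
      where
      h≡ : (h ∸ c) + c ≡ h
      h≡ = m∸n+n≡m (<⇒≤ c<h)
      relative : ∀ {h′} → (∃ λ r′ → h′ ≡ r′ + c × Edge (λ x → W x ≤ c) (q , h ∸ c) (q′ , r′)) →
                 Edge (λ x → W x ≤ c) (q , h ∸ c) (q′ , h′ ∸ c)
      relative (r′ , refl , ed) = subst (λ k → Edge _ (q , h ∸ c) (q′ , k)) (sym (m+n∸n≡m r′ c)) ed

-- Lowering the parameters above a gap

module Lowering (A : OCAPT) (V V₁ : Valuation A) (a G L : ℕ)
    (lowered : ∀ x → V x ≤ a × V₁ x ≡ V x ⊎ G + a ≤ V₁ x × V x ≡ V₁ x + L)
    (wide : 2 + nQ A ≤ G)
    (L-divisible : ∀ d → 0 < d → d ≤ nQ A → d ∣ L) where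

  open Runs A V
  open Runs A V₁ using () renaming (Path to Path₁; Path⁺ to Path₁⁺)
  open Walks A

  0<G : 0 < G
  0<G = ≤-trans (s≤s z≤n) wide

  a<G+a : a < G + a
  a<G+a = m<n+m a 0<G

  G+a≰a : ∀ {h} → G + a ≤ h → ¬ h ≤ a
  G+a≰a G+a≤h h≤a = <⇒≱ a<G+a (≤-trans G+a≤h h≤a)

  separated₁ : ∀ x → V₁ x ≤ a ⊎ G + a ≤ V₁ x
  separated₁ x with lowered x
  ... | inj₁ (Vx≤a , V₁x≡Vx) = inj₁ (subst (_≤ a) (sym V₁x≡Vx) Vx≤a)
  ... | inj₂ (G+a≤V₁x , _)   = inj₂ G+a≤V₁x

  unchanged : ∀ {x} → V₁ x ≤ a → V₁ x ≡ V x
  unchanged {x} V₁x≤a with lowered x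
  ... | inj₁ (_ , V₁x≡Vx)  = V₁x≡Vx
  ... | inj₂ (G+a≤V₁x , _) = contradiction V₁x≤a (G+a≰a G+a≤V₁x)

  Low : Pred (Fin (nX A)) 0ℓ
  Low x = V₁ x ≤ a

  low-passes : Low ⊆ λ x → V x ≤ a
  low-passes V₁x≤a = subst (_≤ a) (unchanged V₁x≤a) V₁x≤a

  low-passes-raised : Low ⊆ λ x → V x ≤ a + L
  low-passes-raised V₁x≤a = ≤-trans (low-passes V₁x≤a) (m≤m+n a L)

  below-gap : ∀ {op h h′} → OpStep V₁ op h h′ → h ≤ a → OpStep V op h h′
  below-gap s+1           _   = s+1
  below-gap s-1           _   = s-1
  below-gap s0            _   = s0
  below-gap sz            _   = sz
  below-gap (seq h≡V₁x)   h≤a = seq (trans h≡V₁x (unchanged (≤-trans (≤-reflexive (sym h≡V₁x)) h≤a)))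
  below-gap (sge V₁x≤h)   h≤a = sge (subst (_≤ _) (unchanged (≤-trans V₁x≤h h≤a)) V₁x≤h)

  above-gap : ∀ {op h h′} → OpStep V₁ op h h′ → G + a ≤ h → OpStep V op (h + L) (h′ + L)
  above-gap s+1 _ = s+1
  above-gap s-1 _ = s-1
  above-gap s0  _ = s0
  above-gap sz  G+a≤0 = contradiction z≤n (G+a≰a G+a≤0)
  above-gap (seq {x} h≡V₁x) G+a≤h with lowered x
  ... | inj₁ (Vx≤a , V₁x≡Vx) = contradiction (subst (_≤ a) (sym (trans h≡V₁x V₁x≡Vx)) Vx≤a) (G+a≰a G+a≤h)
  ... | inj₂ (_ , Vx≡V₁x+L)  = seq (trans (cong (_+ L) h≡V₁x) (sym Vx≡V₁x+L))
  above-gap (sge {x} V₁x≤h) G+a≤h with lowered x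
  ... | inj₁ (Vx≤a , _)      = sge (≤-trans Vx≤a (≤-trans (<⇒≤ a<G+a) (≤-trans G+a≤h (m≤m+n _ L))))
  ... | inj₂ (_ , Vx≡V₁x+L)  = sge (subst (_≤ _) (sym Vx≡V₁x+L) (+-monoˡ-≤ L V₁x≤h))

  step-below : ∀ {q h y} → Step A V₁ (q , h) y → h ≤ a → Step A V (q , h) y
  step-below (step op eq s) h≤a = step op eq (below-gap s h≤a)

  step-above : ∀ {q h q′ h′} → Step A V₁ (q , h) (q′ , h′) → G + a ≤ h → Step A V (q , h + L) (q′ , h′ + L)
  step-above (step op eq s) G+a≤h = step op eq (above-gap s G+a≤h)

  leave-low : ∀ {q h q′ h′} → h ≤ a → a < h′ → Step A V₁ (q , h) (q′ , h′) → h ≡ a × h′ ≡ suc a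
  leave-low h≤a a<h′ s = ≤-antisym h≤a (s≤s⁻¹ (≤-trans a<h′ h′≤1+h)) , ≤-antisym (≤-trans h′≤1+h (s≤s h≤a)) a<h′
    where h′≤1+h = proj₁ (step-unit s)

  leave-high : ∀ {q h q′ h′} → G + a ≤ h → h′ < G + a → Step A V₁ (q , h) (q′ , h′) → h ≡ suc h′ × h′ ≡ pred G + a
  leave-high G+a≤h h′<G+a s =
    ≤-antisym h≤1+h′ (≤-trans h′<G+a G+a≤h) , trans (cong pred 1+h′≡G+a) (+-∸-comm a 0<G)
    where
    h≤1+h′ = proj₂ (step-unit s)
    1+h′≡G+a = ≤-antisym h′<G+a (≤-trans G+a≤h h≤1+h′)

  1+predG≡G : suc (pred G) ≡ G
  1+predG≡G = m+[n∸m]≡n 0<G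

  n≤G : nQ A ≤ G
  n≤G = ≤-trans (m≤n+m _ 2) wide

  0<G+L : 0 < G + L
  0<G+L = ≤-trans 0<G (m≤m+n G L)

  lower : ∀ {x y} → Walk Low x y → Path (x ↑ a) (y ↑ a)
  lower = toPath low-passes

  lower⁺ : ∀ {x y} → Walk Low x y → proj₂ x ≢ proj₂ y → Path⁺ (x ↑ a) (y ↑ a)
  lower⁺ = toPath⁺ low-passes

  raise-edge : ∀ {x y} → Edge Low x y → Step A V (x ↑ a ↑ L) (y ↑ a ↑ L)
  raise-edge {x} {y} e = subst₂ (Step A V) (reassoc x) (reassoc y) (edge-step low-passes-raised e)
    where
    reassoc : ∀ z → z ↑ (a + L) ≡ z ↑ a ↑ L
    reassoc (q , r) = cong (q ,_) (sym (+-assoc r a L))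

  raise : ∀ {x y} → Walk Low x y → Path (x ↑ a ↑ L) (y ↑ a ↑ L)
  raise = gmap (λ x → x ↑ a ↑ L) raise-edge

  raise⁺ : ∀ {x y} → Walk Low x y → proj₂ x ≢ proj₂ y → Path⁺ (x ↑ a ↑ L) (y ↑ a ↑ L)
  raise⁺ w x≢y = gmap⁺ (λ x → x ↑ a ↑ L) raise-edge (nonempty w (x≢y ∘ cong proj₂))

  cross-up : ∀ {q₁ q} → Walk Low (q₁ , 0) (q , G) → Path⁺ ((q₁ , 0) ↑ a) ((q , G) ↑ a ↑ L)
  cross-up {q₁} {q} w = subst (Path⁺ (q₁ , a)) (cong (q ,_) (xy∙z≈xz∙y G L a))
    (lower⁺ (pump-up L-divisible w n≤G) (<⇒≢ 0<G+L))

  cross-down : ∀ {q₁ q} → Walk Low (q₁ , G) (q , 0) → Path⁺ ((q₁ , G) ↑ a ↑ L) ((q , 0) ↑ a)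
  cross-down {q₁} {q} w = subst (λ x → Path⁺ x (q , a)) (cong (q₁ ,_) (xy∙z≈xz∙y G L a))
    (lower⁺ (pump-down L-divisible w n≤G) (>⇒≢ 0<G+L))

  data Band (r : ℕ) : Set where
    bottom : r ≡ 0 → Band r
    inside : 0 < r → r < G → Band r
    top    : r ≡ G → Band r

  band : ∀ r → r ≤ G → Band r
  band zero    _      = bottom refl
  band (suc r) 1+r≤G with suc r <? G
  ... | yes 1+r<G = inside (s≤s z≤n) 1+r<G
  ... | no 1+r≮G  = top (≤-antisym 1+r≤G (≮⇒≥ 1+r≮G))

  -- Sim z b y: a V-path from z tracks the V₁-path that led to y. Heights ≤ a are kept and heights
  -- ≥ G + a are raised by L; inside the band only the walk since entering it is remembered, and its
  -- V-image is fixed on leaving, pumped by L if the band was crossed. With b = true the V-path is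
  -- nonempty, which makes simulated cycles nonempty.
  data Sim (z : Config A) : Bool → Config A → Set where
    low       : ∀ {b q h} → h ≤ a → Path⟨ b ⟩ z (q , h) → Sim z b (q , h)
    high      : ∀ {b q h} → G + a ≤ h → Path⟨ b ⟩ z (q , h + L) → Sim z b (q , h)
    fromBelow : ∀ {b q₁ q r} → 0 < r → r < G →
                Path z ((q₁ , 0) ↑ a) → Walk Low (q₁ , 0) (q , r) → Sim z b ((q , r) ↑ a)
    fromAbove : ∀ {b q₁ q r} → 0 < r → r < G →
                Path z ((q₁ , G) ↑ a ↑ L) → Walk Low (q₁ , G) (q , r) → Sim z b ((q , r) ↑ a)

  simulate-step : ∀ {z b x y} → Sim z b x → Step A V₁ x y → Sim z true y
  simulate-step {b = b} {y = _ , h′} (low h≤a P) s with h′ ≤? a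
  ... | yes h′≤a = low h′≤a (forget b P ▷ step-below s h≤a)
  ... | no h′≰a with leave-low h≤a (≰⇒> h′≰a) s
  ...   | refl , refl = fromBelow (s≤s z≤n) (≤-trans (s≤s (s≤s z≤n)) wide) (forget b P) (up-edge s ◅ ε)
  simulate-step {z} {b} {q , _} {q′ , h′} (high G+a≤h P) s with G + a ≤? h′
  ... | yes G+a≤h′ = high G+a≤h′ (forget b P ▷ step-above s G+a≤h)
  ... | no G+a≰h′ with leave-high G+a≤h (≰⇒> G+a≰h′) s
  ...   | refl , refl = fromAbove (∸-monoˡ-≤ 1 (≤-trans (m≤m+n 2 _) wide)) (≤-reflexive 1+predG≡G)
          (subst (λ k → Path z (q , k + L)) (cong (_+ a) 1+predG≡G) (forget b P))
          (subst (λ k → Edge Low (q , k) (q′ , pred G)) 1+predG≡G (down-edge s) ◅ ε)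
  simulate-step (fromBelow {r = r} 0<r r<G P w) s with band-edge separated₁ 0<r (+-monoˡ-< a r<G) s
  ... | r′ , refl , e with band r′ (≤-trans (proj₁ (edge-unit e)) r<G)
  ...   | bottom refl        = low ≤-refl (P ◅◅⁺ (lower w ▷ edge-step low-passes e))
  ...   | inside 0<r′ r′<G   = fromBelow 0<r′ r′<G P (w ◅◅ e ◅ ε)
  ...   | top refl           = high ≤-refl (P ◅◅⁺ cross-up (w ◅◅ e ◅ ε))
  simulate-step (fromAbove {r = r} 0<r r<G P w) s with band-edge separated₁ 0<r (+-monoˡ-< a r<G) s
  ... | r′ , refl , e with band r′ (≤-trans (proj₁ (edge-unit e)) r<G)
  ...   | bottom refl        = low ≤-refl (P ◅◅⁺ cross-down (w ◅◅ e ◅ ε))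
  ...   | inside 0<r′ r′<G   = fromAbove 0<r′ r′<G P (w ◅◅ e ◅ ε)
  ...   | top refl           = high ≤-refl (P ◅◅⁺ (raise w ▷ raise-edge e))

  simulate-path : ∀ {z x y} → Sim z true x → Path₁ x y → Sim z true y
  simulate-path S ε       = S
  simulate-path S (s ◅ P) = simulate-path (simulate-step S s) P

  simulate⁺ : ∀ {z b x y} → Sim z b x → Path₁⁺ x y → Sim z true y
  simulate⁺ S (_ , s , P) = simulate-path (simulate-step S s) P

  simulate : ∀ {z x y} → Sim z false x → Path₁ x y → ∃ λ b → Sim z b y
  simulate S ε       = false , S
  simulate S (s ◅ P) = true , simulate⁺ S (_ , s , P)

  data Lift : ℕ → ℕ → Set where
    kept   : ∀ {h} → h < G + a → Lift h h
    raised : ∀ {h} → a < h → Lift h (h + L)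

  extract : ∀ {z b q h} → Sim z b (q , h) → ∃ λ H → Path⟨ b ⟩ z (q , H) × Lift h H
  extract (low h≤a P)    = _ , P , kept (≤-<-trans h≤a a<G+a)
  extract (high G+a≤h P) = _ , P , raised (<-≤-trans a<G+a G+a≤h)
  extract {b = b} (fromBelow 0<r r<G P w) = _ , weaken b (P ◅◅⁺ lower⁺ w (<⇒≢ 0<r)) , kept (+-monoˡ-< a r<G)
  extract {b = b} (fromAbove 0<r r<G P w) = _ , weaken b (P ◅◅⁺ raise⁺ w (>⇒≢ r<G)) , raised (m<n+m a 0<r)

  Outside : ℕ → Set
  Outside h = h ≤ a ⊎ G + a ≤ h

  outside? : ∀ h → Dec (Outside h)
  outside? h = h ≤? a ⊎-dec G + a ≤? h

  image : ∀ {h} → Outside h → ℕ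
  image {h} (inj₁ _) = h
  image {h} (inj₂ _) = h + L

  start : ∀ {q h} (o : Outside h) → Sim (q , image o) false (q , h)
  start (inj₁ h≤a)   = low h≤a ε
  start (inj₂ G+a≤h) = high G+a≤h ε

  lift-outside : ∀ {h H} (o : Outside h) → Lift h H → H ≡ image o
  lift-outside (inj₁ _)     (kept _)      = refl
  lift-outside (inj₁ h≤a)   (raised a<h)  = contradiction h≤a (<⇒≱ a<h)
  lift-outside (inj₂ G+a≤h) (kept h<G+a)  = contradiction G+a≤h (<⇒≱ h<G+a)
  lift-outside (inj₂ _)     (raised _)    = refl

  middle-cycle : ∀ {q h H} → a < h → Lift h H →
                 Star⁺ (Edge Low) (q , h ∸ a) (q , h ∸ a) → Path⁺ (q , H) (q , H)
  middle-cycle {q} a<h (kept _) w =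
    subst (λ k → Path⁺ (q , k) (q , k)) (m∸n+n≡m (<⇒≤ a<h)) (gmap⁺ (_↑ a) (edge-step low-passes) w)
  middle-cycle {q} a<h (raised _) w =
    subst (λ k → Path⁺ (q , k + L) (q , k + L)) (m∸n+n≡m (<⇒≤ a<h)) (gmap⁺ (λ x → x ↑ a ↑ L) raise-edge w)

  horizon : ℕ → ℕ
  horizon M = nQ A * suc (M + suc (nQ A))

  module _ (M : ℕ) (G+a≤M : G + a ≤ M) (V₁≤M : ∀ x → V₁ x ≤ M)
           {q₀ ρ} (prefix : IsRunPrefix A V₁ (q₀ , 0) (horizon M) ρ) where

    private
      K = horizon M
      h : ℕ → ℕ
      h t = proj₂ (ρ t)

    step₁ : ∀ t → t < K → Step A V₁ (ρ t) (ρ (suc t))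
    step₁ = proj₂ prefix

    segment : ∀ {i j} → i ≤ j → j ≤ K → Path₁ (ρ i) (ρ j)
    segment i≤j j≤K = chain ρ i≤j (λ t _ t<j → step₁ t (<-≤-trans t<j j≤K))

    segment⁺ : ∀ {i j} → i < j → j ≤ K → Path₁⁺ (ρ i) (ρ j)
    segment⁺ i<j j≤K = chain⁺ ρ i<j (λ t _ t<j → step₁ t (<-≤-trans t<j j≤K))

    reached : ∀ m → m ≤ K → ∃ λ H → Path (q₀ , 0) (proj₁ (ρ m) , H) × Lift (h m) H
    reached m m≤K with simulate (low z≤n ε) (subst (λ x → Path₁ x (ρ m)) (proj₁ prefix) (segment z≤n m≤K))
    ... | b , S with extract S
    ...   | H , P , lift = H , forget b P , lift

    top-passes : (λ x → V₁ x ≤ M) ⊆ λ x → V x ≤ M + L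
    top-passes {x} V₁x≤M with lowered x
    ... | inj₁ (Vx≤a , _)     = ≤-trans Vx≤a (≤-trans (m≤n+m a G) (≤-trans G+a≤M (m≤m+n M L)))
    ... | inj₂ (_ , Vx≡V₁x+L) = subst (_≤ M + L) (sym Vx≡V₁x+L) (+-monoˡ-≤ L V₁x≤M)

    -- Above M every ≥-test passes, so the climb from the last height ≤ M up to h t contains a
    -- rising cycle, which is repeated forever.
    climb : ∀ t → t ≤ K → M + suc (nQ A) < h t → InfRun A V (q₀ , 0)
    climb t t≤K M+1+n<hₜ with last-at-most h M (≤-trans (≤-reflexive (cong proj₂ (proj₁ prefix))) z≤n) t
    ... | ℓ , ℓ≤t , hℓ≤M , above =
      infRun-cycling y cycles (subst (λ k → Path (q₀ , 0) ((s , k) ↑ (M + L))) (sym (+-identityʳ u))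
                                     (into-climb ◅◅ toPath top-passes before))
      where
      M<hₜ : M < h t
      M<hₜ = <-trans (m<m+n M (s≤s z≤n)) M+1+n<hₜ
      ℓ<t : ℓ < t
      ℓ<t = ≤∧≢⇒< ℓ≤t (λ { refl → <⇒≱ M<hₜ hℓ≤M })
      M<h₁ : M < h (suc ℓ)
      M<h₁ = above (suc ℓ) ≤-refl ℓ<t
      walk : Walk (λ x → V₁ x ≤ M) (proj₁ (ρ (suc ℓ)) , h (suc ℓ) ∸ M) (proj₁ (ρ t) , h t ∸ M)
      walk = chain (λ j → proj₁ (ρ j) , h j ∸ M) ℓ<t λ j ℓ<j j<t →
        band-edge↓ (λ x → inj₁ (V₁≤M x)) (above j ℓ<j (<⇒≤ j<t)) (n<1+n (h j)) (step₁ j (<-≤-trans j<t t≤K))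
      climbs : (h (suc ℓ) ∸ M) + nQ A ≤ h t ∸ M
      climbs = begin
        h (suc ℓ) ∸ M + nQ A   ≤⟨ +-monoˡ-≤ (nQ A) (∸-monoˡ-≤ M (≤-trans (proj₁ (step-unit (step₁ ℓ (<-≤-trans ℓ<t t≤K)))) (s≤s hℓ≤M))) ⟩
        suc M ∸ M + nQ A       ≡⟨ cong (_+ nQ A) (m+n∸n≡m 1 M) ⟩
        suc (nQ A)             ≤⟨ m+n≤o⇒m≤o∸n (suc (nQ A)) (subst (_≤ h t) (+-comm M _) (<⇒≤ M+1+n<hₜ)) ⟩
        h t ∸ M                ∎
        where open ≤-Reasoning
      open Ascent (ascent walk climbs)
      y : ℕ → Config A
      y k = (s , u + k * d) ↑ (M + L)
      cycles : ∀ k → Path⁺ (y k) (y (suc k))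
      cycles k = toPath⁺ top-passes (shifted-cycle cycle k) (<⇒≢ (+-monoʳ-< u (m<n+m (k * d) d>0)))
      into-climb : Path (q₀ , 0) ((proj₁ (ρ (suc ℓ)) , h (suc ℓ) ∸ M) ↑ (M + L))
      into-climb with reached (suc ℓ) (≤-trans ℓ<t t≤K)
      ... | H , P , lift = subst (λ k → Path (q₀ , 0) (proj₁ (ρ (suc ℓ)) , k))
                                 (trans (lift-outside (inj₂ G+a≤h₁) lift) (sym restore)) P
        where
        G+a≤h₁ = ≤-trans G+a≤M (<⇒≤ M<h₁)
        restore : (h (suc ℓ) ∸ M) + (M + L) ≡ h (suc ℓ) + L
        restore = trans (sym (+-assoc _ M L)) (cong (_+ L) (m∸n+n≡m (<⇒≤ M<h₁)))

    repeated : (∀ t → t ≤ K → h t ≤ M + suc (nQ A)) → ∃₂ λ i j → i < j × j ≤ K × ρ i ≡ ρ j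
    repeated bounded = from-pigeonhole (Fin.pigeonhole (n<1+n K) code)
      where
      code : Fin (suc K) → Fin K
      code i = combine (proj₁ (ρ (toℕ i))) (fromℕ< (s≤s (bounded (toℕ i) (Fin.toℕ≤pred[n] i))))
      decode : ∀ {i j} → code i ≡ code j → ρ (toℕ i) ≡ ρ (toℕ j)
      decode same = cong₂ _,_ (cong proj₁ parts)
        (trans (sym (Fin.toℕ-fromℕ< _)) (trans (cong (toℕ ∘ proj₂) parts) (Fin.toℕ-fromℕ< _)))
        where
        parts = trans (sym (Fin.remQuot-combine _ _)) (trans (cong (remQuot _) same) (Fin.remQuot-combine _ _))
      from-pigeonhole : (∃₂ λ i j → i <ᶠ j × code i ≡ code j) → ∃₂ λ i j → i < j × j ≤ K × ρ i ≡ ρ j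
      from-pigeonhole (i , j , i<j , same) = toℕ i , toℕ j , i<j , Fin.toℕ≤pred[n] j , decode same

    loop-outside : ∀ {i j m} → i < j → j ≤ K → ρ i ≡ ρ j → i ≤ m → m < j → (o : Outside (h m)) →
                   InfRun A V (q₀ , 0)
    loop-outside {i} {j} {m} i<j j≤K ρᵢ≡ρⱼ i≤m m<j o =
      infRun-cycling (λ _ → proj₁ (ρ m) , image o) (λ _ → at-image (extract around-V)) (at-image (reached m m≤K))
      where
      m≤K = <⇒≤ (<-≤-trans m<j j≤K)
      around : Path₁⁺ (ρ m) (ρ m)
      around = segment⁺ m<j j≤K ⁺◅◅ subst (λ x → Path₁ x (ρ m)) ρᵢ≡ρⱼ (segment i≤m m≤K)
      around-V = simulate⁺ (start o) around
      at-image : ∀ {R : ℕ → Set} → (∃ λ H → R H × Lift (h m) H) → R (image o)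
      at-image {R} (_ , r , lift) = subst R (lift-outside o lift) r

    -- a loop that stays inside the band is a walk, valid at whichever base the prefix reached it
    loop-inside : ∀ {i j} → i < j → j ≤ K → ρ i ≡ ρ j → (∀ m → i ≤ m → m < j → ¬ Outside (h m)) →
                  InfRun A V (q₀ , 0)
    loop-inside {i} {j} i<j j≤K ρᵢ≡ρⱼ never-outside with reached i (<⇒≤ (<-≤-trans i<j j≤K))
    ... | H , P , lift = infRun-cycling (λ _ → proj₁ (ρ i) , H) (λ _ → middle-cycle (in-band i ≤-refl i<j .proj₁) lift cycle) P
      where
      in-band : ∀ m → i ≤ m → m < j → a < h m × h m < G + a
      in-band m i≤m m<j = ≰⇒> (never-outside m i≤m m<j ∘ inj₁) , ≰⇒> (never-outside m i≤m m<j ∘ inj₂)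
      walk : Star⁺ (Edge Low) (proj₁ (ρ i) , h i ∸ a) (proj₁ (ρ j) , h j ∸ a)
      walk = chain⁺ (λ t → proj₁ (ρ t) , h t ∸ a) i<j λ t i≤t t<j →
        band-edge↓ separated₁ (in-band t i≤t t<j .proj₁) (in-band t i≤t t<j .proj₂) (step₁ t (<-≤-trans t<j j≤K))
      cycle : Star⁺ (Edge Low) (proj₁ (ρ i) , h i ∸ a) (proj₁ (ρ i) , h i ∸ a)
      cycle = subst (λ x → Star⁺ (Edge Low) (proj₁ (ρ i) , h i ∸ a) (proj₁ x , proj₂ x ∸ a)) (sym ρᵢ≡ρⱼ) walk

    lowering-run : InfRun A V (q₀ , 0)
    lowering-run with anyUpTo? (λ t → M + suc (nQ A) <? h t) (suc K)
    ... | yes (t , t<1+K , very-high) = climb t (s≤s⁻¹ t<1+K) very-high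
    ... | no never-high with repeated (λ t t≤K → ≮⇒≥ (λ very-high → never-high (t , s≤s t≤K , very-high)))
    ...   | i , j , i<j , j≤K , ρᵢ≡ρⱼ with anyUpTo? (λ m → i ≤? m ×-dec outside? (h m)) j
    ...     | yes (m , m<j , i≤m , o) = loop-outside i<j j≤K ρᵢ≡ρⱼ i≤m m<j o
    ...     | no none = loop-inside i<j j≤K ρᵢ≡ρⱼ (λ m i≤m m<j o → none (m , m<j , i≤m , o))

-- Eliminating gaps

sum-mono-≤ : ∀ {m} {f g : Fin m → ℕ} → (∀ i → f i ≤ g i) → sum f ≤ sum g
sum-mono-≤ {zero}  _   = z≤n
sum-mono-≤ {suc m} f≤g = +-mono-≤ (f≤g zero) (sum-mono-≤ (f≤g ∘ suc))

sum-mono-< : ∀ {m} {f g : Fin m → ℕ} → (∀ i → f i ≤ g i) → ∀ i → f i < g i → sum f < sum g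
sum-mono-< f≤g zero    fᵢ<gᵢ = +-mono-<-≤ fᵢ<gᵢ (sum-mono-≤ (f≤g ∘ suc))
sum-mono-< f≤g (suc i) fᵢ<gᵢ = +-mono-≤-< (f≤g zero) (sum-mono-< (f≤g ∘ suc) i fᵢ<gᵢ)

≤-sum : ∀ {m} (f : Fin m → ℕ) i → f i ≤ sum f
≤-sum f zero    = m≤m+n _ _
≤-sum f (suc i) = ≤-trans (≤-sum (f ∘ suc) i) (m≤n+m _ _)

∣-! : ∀ {d n} → 0 < d → d ≤ n → d ∣ n !
∣-! {suc d} _ d≤n = ∣-trans (m∣m*n (d !)) (m≤n⇒m!∣n! d≤n)

module _ {m} (V : Fin m → ℕ) where

  atMost : ℕ → Subset m
  atMost v = tabulate λ y → does (V y ≤? v)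

  ∈-atMost⁺ : ∀ {v x} → V x ≤ v → x ∈ atMost v
  ∈-atMost⁺ {v} {x} Vx≤v = lookup⇒[]= x _ (trans (lookup∘tabulate _ x) (dec-true (V x ≤? v) Vx≤v))

  ∈-atMost⁻ : ∀ {v x} → x ∈ atMost v → V x ≤ v
  ∈-atMost⁻ {v} {x} x∈ =
    ≤ᵇ⇒≤ (V x) v (subst T (trans (sym ([]=⇒lookup x∈)) (lookup∘tabulate _ x)) _)

  ∣atMost∣>0 : ∀ x → 0 < ∣ atMost (V x) ∣
  ∣atMost∣>0 x = ≤-<-trans z≤n (x∈p⇒∣p-x∣<∣p∣ (∈-atMost⁺ ≤-refl))

  ∣atMost∣-< : ∀ {x y} → V y < V x → ∣ atMost (V y) ∣ < ∣ atMost (V x) ∣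
  ∣atMost∣-< Vy<Vx = p⊂q⇒∣p∣<∣q∣
    ((λ z∈ → ∈-atMost⁺ (≤-trans (∈-atMost⁻ z∈) (<⇒≤ Vy<Vx))) ,
     _ , ∈-atMost⁺ ≤-refl , λ x∈ → <⇒≱ Vy<Vx (∈-atMost⁻ x∈))

gap-width : ℕ → ℕ
gap-width n = 2 + n + n !

module Minimise (A : OCAPT) (F : Subset (nQ A)) (q₀ : Fin (nQ A)) where

  private
    L G width : ℕ
    L = nQ A !
    G = 2 + nQ A
    width = gap-width (nQ A)

  Gap : Valuation A → Fin (nX A) → Set
  Gap V x = width ≤ V x × (∀ y → V y ≤ V x ∸ width ⊎ V x ≤ V y)

  gap? : ∀ V x → Dec (Gap V x)
  gap? V x = width ≤? V x ×-dec Fin.all? λ y → V y ≤? V x ∸ width ⊎-dec V x ≤? V y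

  lowerFrom : Valuation A → ℕ → Valuation A
  lowerFrom V b y with b ≤? V y
  ... | yes _ = V y ∸ L
  ... | no _  = V y

  lowerFrom-≤ : ∀ V b y → lowerFrom V b y ≤ V y
  lowerFrom-≤ V b y with b ≤? V y
  ... | yes _ = m∸n≤m (V y) L
  ... | no _  = ≤-refl

  module _ {V x} (gap : Gap V x) where

    private
      a = V x ∸ width
      V₁ = lowerFrom V (V x)
      G+a+L≡Vx : G + a + L ≡ V x
      G+a+L≡Vx = trans (xy∙z≈y∙xz G a L) (m∸n+n≡m (proj₁ gap))

    lowerFrom-lowered : ∀ y → V y ≤ a × V₁ y ≡ V y ⊎ G + a ≤ V₁ y × V y ≡ V₁ y + L
    lowerFrom-lowered y with V x ≤? V y | proj₂ gap y
    ... | yes Vx≤Vy | _         = inj₂ (m+n≤o⇒m≤o∸n (G + a) G+a+L≤Vy , sym (m∸n+n≡m (≤-trans (m≤n+m L G) (≤-trans (proj₁ gap) Vx≤Vy))))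
      where
      G+a+L≤Vy : (G + a) + L ≤ V y
      G+a+L≤Vy = ≤-trans (≤-reflexive G+a+L≡Vx) Vx≤Vy
    ... | no _       | inj₁ Vy≤a = inj₁ (Vy≤a , refl)
    ... | no Vx≰Vy  | inj₂ Vx≤Vy = contradiction Vx≤Vy Vx≰Vy

    lowerFrom-< : V₁ x < V x
    lowerFrom-< with V x ≤? V x
    ... | yes _ = ∸-monoʳ-< (1≤n! (nQ A)) (≤-trans (m≤n+m L G) (proj₁ gap))
    ... | no Vx≰Vx = contradiction ≤-refl Vx≰Vx

    lowering-preserves : AllInfRunsReach A V q₀ F → AllInfRunsReach A V₁ q₀ F
    lowering-preserves = reach-transfer (horizon (sum V)) λ _ → lowering-run (sum V) G+a≤M V₁≤M
      where
      open Lowering (A ∖ F) V V₁ a G L lowerFrom-lowered ≤-refl (λ _ → ∣-!)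
      G+a≤M : G + a ≤ sum V
      G+a≤M = ≤-trans (m≤m+n (G + a) L) (≤-trans (≤-reflexive G+a+L≡Vx) (≤-sum V x))
      V₁≤M : ∀ y → V₁ y ≤ sum V
      V₁≤M y = ≤-trans (lowerFrom-≤ V (V x) y) (≤-sum V y)

  -- without a gap every value lies within width of a smaller value or of 0
  no-gap-bound : ∀ V → (∀ x → ¬ Gap V x) → ∀ x → V x ≤ ∣ atMost V (V x) ∣ * width
  no-gap-bound V no-gap x = <-rec P bound (V x) x refl
    where
    P : ℕ → Set
    P v = ∀ x → V x ≡ v → V x ≤ ∣ atMost V v ∣ * width
    bound : ∀ v → (∀ {u} → u < v → P u) → P v
    bound _ rec x refl with width ≤? V x
    ... | no Vx≱width = ≤-trans (<⇒≤ (≰⇒> Vx≱width)) (≤-trans (≤-reflexive (sym (*-identityˡ width))) (*-monoˡ-≤ width (∣atMost∣>0 V x)))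
    ... | yes width≤Vx with Fin.¬∀⟶∃¬ _ _ (λ y → V y ≤? V x ∸ width ⊎-dec V x ≤? V y) (no-gap x ∘ (width≤Vx ,_))
    ...   | y , between = begin
      V x                               ≡⟨ m∸n+n≡m width≤Vx ⟨
      V x ∸ width + width               ≤⟨ +-monoˡ-≤ width (<⇒≤ (≰⇒> (between ∘ inj₁))) ⟩
      V y + width                       ≤⟨ +-monoˡ-≤ width (rec Vy<Vx y refl) ⟩
      ∣ atMost V (V y) ∣ * width + width ≡⟨ +-comm _ width ⟩
      suc ∣ atMost V (V y) ∣ * width    ≤⟨ *-monoˡ-≤ width (∣atMost∣-< V Vy<Vx) ⟩
      ∣ atMost V (V x) ∣ * width        ∎
      where
      open ≤-Reasoning
      Vy<Vx = ≰⇒> (between ∘ inj₂)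

  bounded-valuation : ∀ V → AllInfRunsReach A V q₀ F →
                      ∃ λ V′ → (∀ x → V′ x ≤ nX A * gap-width (nQ A)) × AllInfRunsReach A V′ q₀ F
  bounded-valuation V = <-rec P shrink (sum V) V refl
    where
    P : ℕ → Set
    P k = ∀ V → sum V ≡ k → AllInfRunsReach A V q₀ F →
          ∃ λ V′ → (∀ x → V′ x ≤ nX A * width) × AllInfRunsReach A V′ q₀ F
    shrink : ∀ k → (∀ {j} → j < k → P j) → P k
    shrink _ rec V refl reach with Fin.any? (gap? V)
    ... | yes (x , gap) = rec (sum-mono-< (lowerFrom-≤ V (V x)) x (lowerFrom-< gap)) _ refl (lowering-preserves gap reach)
    ... | no no-gap     = V , (λ x → ≤-trans (no-gap-bound V (λ x gap → no-gap (x , gap)) x) (*-monoˡ-≤ width (∣p∣≤n (atMost V (V x))))) , reach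

-- Size bound

k≤2^k : ∀ k → k ≤ 2 ^ k
k≤2^k zero    = z≤n
k≤2^k (suc k) = +-mono-≤ (m^n>0 2 k) (≤-trans (k≤2^k k) (m≤m+n _ 0))

k!≤2^[k*k] : ∀ k → k ! ≤ 2 ^ (k * k)
k!≤2^[k*k] zero    = ≤-refl
k!≤2^[k*k] (suc k) = begin
  suc k * k !               ≤⟨ *-mono-≤ (k≤2^k (suc k)) (k!≤2^[k*k] k) ⟩
  2 ^ suc k * 2 ^ (k * k)   ≡⟨ ^-distribˡ-+-* 2 (suc k) (k * k) ⟨
  2 ^ (suc k + k * k)       ≤⟨ ^-monoʳ-≤ 2 (+-monoʳ-≤ (suc k) (*-monoʳ-≤ k (n≤1+n k))) ⟩
  2 ^ (suc k * suc k)       ∎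
  where open ≤-Reasoning

x+x≤s*x : ∀ {s} x → 2 ≤ s → x + x ≤ s * x
x+x≤s*x x 2≤s = ≤-trans (≤-reflexive (cong (x +_) (sym (+-identityʳ x)))) (*-monoˡ-≤ x 2≤s)

parameter-bound : ∀ n t m → 0 < n → 0 < m → m * gap-width n ≤ 2 ^ ((n + t + m) ^ 3)
parameter-bound n t m 0<n 0<m = begin
  m * gap-width n                    ≤⟨ *-mono-≤ (≤-trans m≤s (k≤2^k s)) (+-mono-≤ 2+n≤X n!≤X) ⟩
  2 ^ s * (X + X)                    ≡⟨ cong (2 ^ s *_) (cong (X +_) (+-identityʳ X)) ⟨
  2 ^ s * 2 ^ suc (s * s)            ≡⟨ ^-distribˡ-+-* 2 s (suc (s * s)) ⟨
  2 ^ (s + suc (s * s))              ≤⟨ ^-monoʳ-≤ 2 exponent ⟩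
  2 ^ (s ^ 3)                        ∎
  where
  open ≤-Reasoning
  s = n + t + m
  X = 2 ^ (s * s)
  n≤s : n ≤ s
  n≤s = ≤-trans (m≤m+n n t) (m≤m+n _ m)
  m≤s : m ≤ s
  m≤s = m≤n+m m (n + t)
  2≤s : 2 ≤ s
  2≤s = ≤-trans (+-mono-≤ 0<n 0<m) (+-monoˡ-≤ m (m≤m+n n t))
  2+n≤X : 2 + n ≤ X
  2+n≤X = ≤-trans (+-mono-≤ 2≤s n≤s) (≤-trans (x+x≤s*x s 2≤s) (k≤2^k (s * s)))
  n!≤X : n ! ≤ X
  n!≤X = ≤-trans (k!≤2^[k*k] n) (^-monoʳ-≤ 2 (*-mono-≤ n≤s n≤s))
  exponent : s + suc (s * s) ≤ s ^ 3
  exponent = begin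
    s + suc (s * s)     ≡⟨ +-suc s (s * s) ⟩
    suc s + s * s       ≤⟨ +-monoˡ-≤ (s * s) (≤-trans (+-monoˡ-≤ s (≤-trans (s≤s z≤n) 2≤s)) (x+x≤s*x s 2≤s)) ⟩
    s * s + s * s       ≤⟨ x+x≤s*x (s * s) 2≤s ⟩
    s * (s * s)         ≡⟨ cong (λ k → s * (s * k)) (*-identityʳ s) ⟨
    s ^ 3               ∎

lemma22 : ∃ λ (c : ℕ) → ∀ (A : OCAPT) (q0 : Fin (nQ A)) (F : Subset (nQ A)) →
            (∃ λ (V : Valuation A) → AllInfRunsReach A V q0 F) →
            ∃ λ (V' : Valuation A) →
              (∀ (x : Fin (nX A)) → V' x ≤ 2 ^ (size A ^ c)) × AllInfRunsReach A V' q0 F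
lemma22 = 3 , λ A q0 F (V , reach) →
  let V′ , V′≤ , reach′ = Minimise.bounded-valuation A F q0 V reach
  in  V′ , (λ x → ≤-trans (V′≤ x) (parameter-bound (nQ A) (nTrans A) (nX A) (inhabited q0) (inhabited x))) , reach′
  where
  inhabited : ∀ {k} → Fin k → 0 < k
  inhabited {suc _} _ = s≤s z≤n
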